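{- Let $\mathfrak{C}$ be a class of dynamic operators satisfying (GR) and $\mathfrak{M}\subseteq \mathit{Mod}(\mathcal{L}_\leq)$ be a class of preference models. The following axiom schema is valid in $\langle \mathfrak{M}, \mathfrak{C}\rangle$, for any propositional formula $\varphi \in \mathcal{L}_0$: $$ (\mu\neg \varphi \vee \mu \top) \leftrightarrow [\star\varphi]\mu\top$$
   Context: Fix a set $P$ of propositional letters; $\mathcal{L}_0$ is the classical propositional language over $P$. A (well-founded) preference model is $M=\langle W,\leq,v\rangle$ with $W$ a set of worlds, $\leq$ a reflexive, transitive relation on $W$ whose strict part $<$ is well-founded, and $v:P\to 2^W$ a valuation; $\mathit{Mod}(\mathcal{L}_\leq)$ is the class of all such models. A dynamic operator is a map $\star:\mathit{Mod}(\mathcal{L}_\leq)\times\mathcal{L}_0\to\mathit{Mod}(\mathcal{L}_\leq)$ with $\star(M,\varphi)=\langle W,\leq_{\star\varphi},v\rangle$ (same worlds and valuation). The language $\mathcal{L}_\leq(\star)$ is built from $P$ with $\neg,\wedge$, the universal modality $A$, the modalities $[\leq]$, $[<]$ (dual $\langle<\rangle$), and formulas $[\star\varphi]\xi$ with $\varphi\in\mathcal{L}_0$. A dynamic model is $D=\langle M,\star\rangle$, with standard clauses for $A,[\leq],[<]$ and $D,w\vDash[\star\varphi]\xi$ iff $\langle\star(M,\varphi),\star\rangle,w\vDash\xi$. For a class $\mathfrak{M}$ of preference models and a class $\mathfrak{C}$ of dynamic operators closed over $\mathfrak{M}$, $\langle\mathfrak{M},\mathfrak{C}\rangle$ is the class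 of dynamic models $\langle M,\star\rangle$ with $M\in\mathfrak{M}$, $\star\in\mathfrak{C}$; a formula is valid in it if true at every world of every such model. $[\![\varphi]\!]$ denotes the set of worlds of the model satisfying $\varphi$; $Min_\leq X=\{w\in X\mid$ there is no $w'\in X$ with $w'<w\}$. $\mu\varphi:=\varphi\wedge\neg\langle<\rangle\varphi$, which holds at $w$ iff $w\in Min_\leq[\![\varphi]\!]$. $\star$ satisfies (GR) (Grove's characterization of AGM contraction) if $Min_{\leq_{\star\varphi}}W = Min_\leq W\cup Min_\leq[\![\neg\varphi]\!]$. -}

module Defs where

open import Level using (0ℓ)
open import Data.Product using (_×_; Σ; _,_)
open import Data.Empty using (⊥)
open import Data.Unit using (⊤)
open import Relation.Nullary using (¬_)
open import Relation.Unary using (Pred; _∪_; _≐_)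
open import Induction.WellFounded using (WellFounded)

data Form₀ (P : Set) : Set where
  atom : P → Form₀ P
  ⊤₀   : Form₀ P
  ¬₀_  : Form₀ P → Form₀ P
  _∧₀_ : Form₀ P → Form₀ P → Form₀ P

module _ {W : Set} (_≤_ : W → W → Set) where
  Strict : W → W → Set
  Strict x y = (x ≤ y) × ¬ (y ≤ x)

record PrefOrder (W : Set) : Set₁ where
  field
    _≤_    : W → W → Set
    refl   : ∀ {x} → x ≤ x
    trans  : ∀ {x y z} → x ≤ y → y ≤ z → x ≤ z
    wf     : WellFounded (Strict _≤_)

  _<_ : W → W → Set
  _<_ = Strict _≤_

record PrefModel (P : Set) : Set₁ where
  field
    W   : Set
    ord : PrefOrder W
    v   : P → Pred W 0ℓ
  open PrefOrder ord public

open PrefModel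

Min : {W : Set} → PrefOrder W → Pred W 0ℓ → Pred W 0ℓ
Min O X w = X w × ¬ (Σ _ λ w' → X w' × PrefOrder._<_ O w' w)

All : {W : Set} → Pred W 0ℓ
All _ = ⊤

⟦_⟧₀ : {P : Set} → Form₀ P → (M : PrefModel P) → Pred (W M) 0ℓ
⟦ atom p ⟧₀ M w = v M p w
⟦ ⊤₀ ⟧₀ M w = ⊤
⟦ ¬₀ φ ⟧₀ M w = ¬ (⟦ φ ⟧₀ M w)
⟦ φ ∧₀ ψ ⟧₀ M w = ⟦ φ ⟧₀ M w × ⟦ ψ ⟧₀ M w

-- Dynamic operators: ⋆(M, φ) = ⟨W, ≤_{⋆φ}, v⟩ (same worlds and
-- valuation; the new order is again a well-founded preorder).

DynOp : Set → Set₁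
DynOp P = (M : PrefModel P) → Form₀ P → PrefOrder (W M)

apply : {P : Set} → DynOp P → PrefModel P → Form₀ P → PrefModel P
apply ⋆ M φ = record { W = W M ; ord = ⋆ M φ ; v = v M }

GR : {P : Set} → DynOp P → Set₁
GR {P} ⋆ = (M : PrefModel P) (φ : Form₀ P) →
  Min (⋆ M φ) All ≐ (Min (ord M) All ∪ Min (ord M) (⟦ ¬₀ φ ⟧₀ M))

ClosedOver : {P : Set} → (PrefModel P → Set) → (DynOp P → Set) → Set₁
ClosedOver {P} 𝔐 ℭ = (M : PrefModel P) (⋆ : DynOp P) (φ : Form₀ P) →
  𝔐 M → ℭ ⋆ → 𝔐 (apply ⋆ M φ)

data Form (P : Set) : Set where
  atom   : P → Form P
  ⊤'     : Form P
  ¬'_    : Form P → Form P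
  _∧'_   : Form P → Form P → Form P
  𝔸      : Form P → Form P
  [≤]_   : Form P → Form P
  [<]_   : Form P → Form P
  [⋆_]_  : Form₀ P → Form P → Form P

emb : {P : Set} → Form₀ P → Form P
emb (atom p) = atom p
emb ⊤₀ = ⊤'
emb (¬₀ φ) = ¬' emb φ
emb (φ ∧₀ ψ) = emb φ ∧' emb ψ

_∨'_ : {P : Set} → Form P → Form P → Form P
φ ∨' ψ = ¬' ((¬' φ) ∧' (¬' ψ))

_→'_ : {P : Set} → Form P → Form P → Form P
φ →' ψ = ¬' (φ ∧' (¬' ψ))

_↔'_ : {P : Set} → Form P → Form P → Form P
φ ↔' ψ = (φ →' ψ) ∧' (ψ →' φ)

⟨<⟩_ : {P : Set} → Form P → Form P
⟨<⟩ φ = ¬' ([<] (¬' φ))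

μ : {P : Set} → Form P → Form P
μ φ = φ ∧' (¬' (⟨<⟩ φ))

Sat : {P : Set} → (M : PrefModel P) → DynOp P → Form P → Pred (W M) 0ℓ
Sat M ⋆ (atom p) w = v M p w
Sat M ⋆ ⊤' w = ⊤
Sat M ⋆ (¬' ξ) w = ¬ Sat M ⋆ ξ w
Sat M ⋆ (ξ ∧' χ) w = Sat M ⋆ ξ w × Sat M ⋆ χ w
Sat M ⋆ (𝔸 ξ) w = ∀ u → Sat M ⋆ ξ u
Sat M ⋆ ([≤] ξ) w = ∀ u → _≤_ M w u → Sat M ⋆ ξ u
Sat M ⋆ ([<] ξ) w = ∀ u → _<_ M u w → Sat M ⋆ ξ u
Sat M ⋆ ([⋆ φ ] ξ) w = Sat (apply ⋆ M φ) ⋆ ξ w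

Valid : {P : Set} → (PrefModel P → Set) → (DynOp P → Set) → Form P → Set₁
Valid {P} 𝔐 ℭ ξ = (M : PrefModel P) (⋆ : DynOp P) → 𝔐 M → ℭ ⋆ →
  (w : W M) → Sat M ⋆ ξ w

-- By (GR) a world is ≤⋆φ-minimal in W iff it is ≤-minimal in W or in ⟦¬φ⟧,
-- and μ ψ holds exactly at the ≤-minimal ψ-worlds; so both sides of the
-- biconditional describe the same set of worlds, in any model whatsoever. Only the truth of the
-- connectives in L_≤(⋆) is classical, and a biconditional between a
-- double-negated disjunction and anything else is stable, so the argument
-- is constructive.
module Submission where

open import Defs
open import Level using (0ℓ)
open import Data.Product using (_,_; proj₁; proj₂)
open import Data.Sum using (_⊎_; inj₁; inj₂; [_,_]; swap) renaming (map to ⊎-map)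
open import Relation.Unary using (Pred; _∪_; _⊆_; _≐_)
open import Relation.Unary.Properties using (≐-sym; ≐-trans)

Min-resp-≐ : {W : Set} (O : PrefOrder W) {X Y : Pred W 0ℓ} →
  X ≐ Y → Min O X ≐ Min O Y
Min-resp-≐ O (X⊆Y , Y⊆X) = Min-mono X⊆Y Y⊆X , Min-mono Y⊆X X⊆Y
  where
  Min-mono : ∀ {X Y} → X ⊆ Y → Y ⊆ X → Min O X ⊆ Min O Y
  Min-mono X⊆Y Y⊆X (x , noneBelow) =
    X⊆Y x , λ (u , yu , u<w) → noneBelow (u , Y⊆X yu , u<w)

∪-swap-resp-≐ : {W : Set} {X X′ Y Y′ : Pred W 0ℓ} →
  X ≐ X′ → Y ≐ Y′ → (X ∪ Y) ≐ (Y′ ∪ X′)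
∪-swap-resp-≐ (X⊆X′ , X′⊆X) (Y⊆Y′ , Y′⊆Y) =
  (λ xy → swap (⊎-map X⊆X′ Y⊆Y′ xy)) , (λ yx → swap (⊎-map Y′⊆Y X′⊆X yx))

module _ {P : Set} (M : PrefModel P) (⋆ : DynOp P) where
  open PrefModel M using (ord)

  Sat-emb : (φ : Form₀ P) → Sat M ⋆ (emb φ) ≐ ⟦ φ ⟧₀ M
  Sat-emb (atom p) = (λ s → s) , (λ s → s)
  Sat-emb ⊤₀       = (λ s → s) , (λ s → s)
  Sat-emb (¬₀ φ)   = (λ ¬s t → ¬s (proj₂ (Sat-emb φ) t))
                   , (λ ¬t s → ¬t (proj₁ (Sat-emb φ) s))
  Sat-emb (φ ∧₀ ψ) = (λ (s , t) → proj₁ (Sat-emb φ) s , proj₁ (Sat-emb ψ) t)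
                   , (λ (s , t) → proj₂ (Sat-emb φ) s , proj₂ (Sat-emb ψ) t)

  Sat-μ : (ξ : Form P) → Sat M ⋆ (μ ξ) ≐ Min ord (Sat M ⋆ ξ)
  Sat-μ ξ = (λ (s , ¬below) → s , λ (u , su , u<w) → ¬below (λ k → k u u<w su))
          , (λ (s , noneBelow) → s , λ ¬[<]¬ξ →
               ¬[<]¬ξ (λ u u<w su → noneBelow (u , su , u<w)))

  Sat-μ-emb : (φ : Form₀ P) → Sat M ⋆ (μ (emb φ)) ≐ Min ord (⟦ φ ⟧₀ M)
  Sat-μ-emb φ = ≐-trans (Sat-μ (emb φ)) (Min-resp-≐ ord (Sat-emb φ))

  ∨'-↔'-intro : (ξ χ ζ : Form P) → Sat M ⋆ ζ ≐ (Sat M ⋆ ξ ∪ Sat M ⋆ χ) →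
    ∀ w → Sat M ⋆ ((ξ ∨' χ) ↔' ζ) w
  ∨'-↔'-intro ξ χ ζ (ζ⊆ξ∪χ , ξ∪χ⊆ζ) w =
      (λ (¬¬ξ∨χ , ¬ζ) → ¬¬ξ∨χ ( (λ s → ¬ζ (ξ∪χ⊆ζ (inj₁ s)))
                              , (λ s → ¬ζ (ξ∪χ⊆ζ (inj₂ s)))))
    , (λ (ζ , ¬¬[¬ξ∧¬χ]) → ¬¬[¬ξ∧¬χ] (λ (¬ξ , ¬χ) → [ ¬ξ , ¬χ ] (ζ⊆ξ∪χ ζ)))

GR⇒Sat-[⋆]μ⊤ : {P : Set} (M : PrefModel P) (⋆ : DynOp P) → GR ⋆ →
  (φ : Form₀ P) →
  Sat M ⋆ ([⋆ φ ] μ ⊤') ≐ (Sat M ⋆ (μ (emb (¬₀ φ))) ∪ Sat M ⋆ (μ ⊤'))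
GR⇒Sat-[⋆]μ⊤ M ⋆ gr φ =
  ≐-trans (Sat-μ (apply ⋆ M φ) ⋆ ⊤')
    (≐-trans (gr M φ)
      (∪-swap-resp-≐ (≐-sym (Sat-μ M ⋆ ⊤')) (≐-sym (Sat-μ-emb M ⋆ (¬₀ φ)))))

proposition41 : (P : Set) (𝔐 : PrefModel P → Set) (ℭ : DynOp P → Set) →
    ClosedOver 𝔐 ℭ → (∀ ⋆ → ℭ ⋆ → GR ⋆) → (φ : Form₀ P) →
    Valid 𝔐 ℭ ((μ (emb (¬₀ φ)) ∨' μ ⊤') ↔' ([⋆ φ ] μ ⊤'))
proposition41 P 𝔐 ℭ _ gr φ M ⋆ _ ⋆∈ℭ w =
  ∨'-↔'-intro M ⋆ (μ (emb (¬₀ φ))) (μ ⊤') ([⋆ φ ] μ ⊤')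
    (GR⇒Sat-[⋆]μ⊤ M ⋆ (gr ⋆ ⋆∈ℭ) φ) w
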